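{- Let $D$ be a digraph with $n$ vertices that contains a directed cycle, and let $g$ be its girth. Then in the chromatic polynomial $P(D;x)$ the coefficients of $x^{n-1},\ldots,x^{n-g+2}$ are zero, and the coefficient of $x^{n-g+1}$ equals $-N_g$, where $N_g$ is the number of directed cycles of length $g$ in $D$.
   Context: All digraphs are finite, loopless and strict (at most one edge from $u$ to $v$ for distinct $u,v$). The girth is the length of a shortest directed cycle. For a positive integer $k$, a proper $k$-coloring of $D$ is a map $V(D)\to\{1,\ldots,k\}$ such that each color class induces a subdigraph with no directed cycle. The number of proper $k$-colorings is a polynomial in $k$, denoted $P(D;x)$ (the chromatic, or dichromatic, polynomial of $D$). -}

module Defs where

open import Data.Nat using (ℕ; zero; suc; _≤ᵇ_; _≤_)
open import Data.Vec using (Vec; lookup; []; _∷_)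
open import Data.Bool using (Bool; true; false; _∧_; not; if_then_else_)
open import Data.Fin using (Fin; toℕ) renaming (_≟_ to _≟ᶠ_)
open import Data.List using (List; []; _∷_; map; concatMap; upTo; allFin)
open import Data.Bool.ListAction using (all; any)
open import Data.Integer using (ℤ; +_; _+_; _*_)
open import Relation.Nullary.Decidable using (⌊_⌋)
open import Relation.Binary.PropositionalEquality using (_≡_)

-- A digraph on the vertex set Fin n: an adjacency relation (at most one
-- edge u → v, so the digraph is strict) with no loops.
record Digraph (n : ℕ) : Set where
  field
    adj      : Fin n → Fin n → Bool
    loopless : ∀ i → adj i i ≡ false
open Digraph public

seqs : (m : ℕ) → ℕ → List (List (Fin m))
seqs m zero    = [] ∷ []
seqs m (suc l) = concatMap (λ x → map (x ∷_) (seqs m l)) (allFin m)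

distinct : ∀ {n} → List (Fin n) → Bool
distinct []       = true
distinct (x ∷ xs) = not (any (λ y → ⌊ x ≟ᶠ y ⌋) xs) ∧ distinct xs

pathEdges : ∀ {n} → Digraph n → List (Fin n) → Bool
pathEdges D []           = true
pathEdges D (x ∷ [])     = true
pathEdges D (x ∷ y ∷ ys) = adj D x y ∧ pathEdges D (y ∷ ys)

lastOr : ∀ {n} → Fin n → List (Fin n) → Fin n
lastOr d []       = d
lastOr d (x ∷ xs) = lastOr x xs

isCycle : ∀ {n} → Digraph n → List (Fin n) → Bool
isCycle D []           = false
isCycle D (x ∷ [])     = false
isCycle D (x ∷ y ∷ ys) =
  distinct (x ∷ y ∷ ys) ∧ pathEdges D (x ∷ y ∷ ys) ∧ adj D (lastOr y ys) x

hasCycleOfLength : ∀ {n} → Digraph n → ℕ → Bool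
hasCycleOfLength {n} D l = any (isCycle D) (seqs n l)

-- canonical representative of a cycle (a cyclic rotation class of vertex
-- sequences): the first vertex is the smallest one
startsAtMin : ∀ {n} → List (Fin n) → Bool
startsAtMin []       = true
startsAtMin (x ∷ xs) = all (λ y → toℕ x ≤ᵇ toℕ y) xs

count : ∀ {A : Set} → (A → Bool) → List A → ℕ
count p []       = 0
count p (x ∷ xs) = if p x then suc (count p xs) else count p xs

numCycles : ∀ {n} → Digraph n → ℕ → ℕ
numCycles {n} D l =
  count (λ vs → isCycle D vs ∧ startsAtMin vs) (seqs n l)

vecs : (m : ℕ) → (l : ℕ) → List (Vec (Fin m) l)
vecs m zero    = [] ∷ []
vecs m (suc l) = concatMap (λ x → map (x ∷_) (vecs m l)) (allFin m)

monochromatic : ∀ {n k} → (Fin n → Fin k) → List (Fin n) → Bool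
monochromatic col []       = true
monochromatic col (x ∷ xs) = all (λ y → ⌊ col x ≟ᶠ col y ⌋) xs

-- a colouring is proper iff no colour class induces a subdigraph with a
-- directed cycle (cycles have distinct vertices, so lengths ≤ n suffice)
isProper : ∀ {n k} → Digraph n → (Fin n → Fin k) → Bool
isProper {n} D col =
  all (λ l → all (λ vs → not (isCycle D vs ∧ monochromatic col vs)) (seqs n l))
      (upTo (suc n))

numColourings : ∀ {n} → Digraph n → ℕ → ℕ
numColourings {n} D k = count (λ c → isProper D (lookup c)) (vecs k n)

-- integer polynomials as coefficient lists a₀ ∷ a₁ ∷ … (a_j is the
-- coefficient of x^j)
eval : List ℤ → ℤ → ℤ
eval []       x = + 0
eval (a ∷ as) x = a + x * eval as x

coeff : List ℤ → ℕ → ℤ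
coeff []       j       = + 0
coeff (a ∷ as) zero    = a
coeff (a ∷ as) (suc j) = coeff as j

IsChromaticPolynomial : ∀ {n} → Digraph n → List ℤ → Set
IsChromaticPolynomial D p = ∀ (k : ℕ) → 1 ≤ k → eval p (+ k) ≡ + numColourings D k

module Submission where

-- With m = n − g, let I(k)
-- = k^n − P(D;k) count the improper k-colourings and N the g-cycles (each
-- taken as its rotation starting at the least vertex). Per colouring,
--   [improper] ≤ #mono g-cycles + #mono longer cycles, and
--   #mono g-cycles ≤ [improper] + #ordered pairs of mono g-cycles.
-- Summed over colourings: a g-cycle is monochromatic under k·k^m of them, a
-- longer cycle under ≤ k^m, and two different g-cycles jointly under ≤ k^m,
-- since in girth g a g-cycle is chordless, hence the only cycle on its
-- vertex set, so two of them span ≥ g + 1 vertices. Thus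
-- P(D;k) = k^n − N·k^(m+1) + O(k^m), and a polynomial that is O(k^m) has no
-- coefficients above degree m.

open import Defs
open import Data.Nat using (ℕ; zero; suc; _+_; _*_; _^_; _≤_; _<_; _∸_; _≤ᵇ_; _<ᵇ_; z≤n; s≤s)
open import Data.Nat.Properties
open import Algebra.Properties.CommutativeSemigroup +-commutativeSemigroup using (interchange)
open import Data.Bool using (Bool; true; false; T; _∧_; _∨_; not; if_then_else_)
open import Data.Bool.Properties using (∧-assoc; ∧-comm; ∧-identityʳ; T-≡)
open import Data.Bool.ListAction using (all; any)
open import Data.Fin using (Fin; toℕ) renaming (zero to fz; suc to fs; _≟_ to _≟ᶠ_)
import Data.Fin.Properties as Finₚ
open import Data.Integer as ℤ using (ℤ; +_; -_; ∣_∣)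
import Data.Integer.Properties as ℤₚ
open import Data.Integer.Tactic.RingSolver using (solve-∀)
open import Data.Nat.Tactic.RingSolver using () renaming (solve-∀ to solve-ℕ)
open import Data.List using (List; []; _∷_; _++_; [_]; map; concatMap; allFin; length; tabulate; upTo)
open import Data.List.Properties using (++-assoc; length-++; length-++-comm; ++-identityʳ; ∷-injectiveˡ; ≡-dec)
open import Data.List.Membership.Propositional using (_∈_)
open import Data.List.Membership.Propositional.Properties
  using (∈-allFin; ∈-concatMap⁺; ∈-concatMap⁻; ∈-map⁺; ∈-map⁻; ∈-∃++; ∈-++⁺ˡ; ∈-++⁺ʳ; ∈-++⁻; ∈-upTo⁺)
open import Data.List.Relation.Unary.Any using (here; there)
import Data.List.Relation.Unary.Any as Any
import Data.List.Relation.Unary.All as All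
open import Data.List.Extrema ≤-totalOrder using (argmin; argmin-sel; f[argmin]≤f[⊤]; f[argmin]≤f[xs])
open import Data.Vec using (Vec; lookup) renaming ([] to []ᵥ; _∷_ to _∷ᵥ_)
open import Data.Product using (Σ; _×_; _,_; proj₁; proj₂)
open import Data.Sum using (inj₁; inj₂)
open import Data.Empty using (⊥; ⊥-elim)
open import Function using (_∘_; _∘′_; case_of_; Equivalence)
open import Relation.Nullary using (¬_)
open import Relation.Nullary.Decidable using (⌊_⌋; yes; no; isYes≗does; ⌊⌋-map′)
open import Relation.Binary using (tri<; tri≈; tri>)
open import Relation.Binary.PropositionalEquality hiding ([_])

∧-elim : ∀ {a b} → a ∧ b ≡ true → a ≡ true × b ≡ true
∧-elim {true} {true} _ = refl , refl

∧-intro : ∀ {a b} → a ≡ true → b ≡ true → a ∧ b ≡ true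
∧-intro refl refl = refl

not-true : ∀ {a} → not a ≡ true → a ≡ false
not-true {false} _ = refl

not-false : ∀ {a} → not a ≡ false → a ≡ true
not-false {true} _ = refl

T⇒≡true : ∀ {a} → T a → a ≡ true
T⇒≡true = Equivalence.to T-≡

≡true⇒T : ∀ {a} → a ≡ true → T a
≡true⇒T = Equivalence.from T-≡

-- The indicator of a Boolean, and finite sums over a list and over Fin n;
-- counts are sums of indicators, which turns counting arguments into
-- manipulations of sums.
ind : Bool → ℕ
ind true  = 1
ind false = 0

ind-mono : ∀ {a b} → (a ≡ true → b ≡ true) → ind a ≤ ind b
ind-mono {false} h = z≤n
ind-mono {true}  h rewrite h refl = s≤s z≤n

sumL : ∀ {A : Set} → (A → ℕ) → List A → ℕ
sumL f []       = 0
sumL f (x ∷ xs) = f x + sumL f xs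

sumF : ∀ {n} → (Fin n → ℕ) → ℕ
sumF {zero}  f = 0
sumF {suc n} f = f fz + sumF (f ∘ fs)

module _ {A : Set} where

  count-sum : (p : A → Bool) (xs : List A) → count p xs ≡ sumL (ind ∘ p) xs
  count-sum p [] = refl
  count-sum p (x ∷ xs) with p x
  ... | true  = cong suc (count-sum p xs)
  ... | false = count-sum p xs

  sumL-++ : (f : A → ℕ) (xs ys : List A) → sumL f (xs ++ ys) ≡ sumL f xs + sumL f ys
  sumL-++ f []       ys = refl
  sumL-++ f (x ∷ xs) ys = trans (cong (λ w → f x + w) (sumL-++ f xs ys)) (sym (+-assoc (f x) _ _))

  sumL-ext∈ : {f g : A → ℕ} (xs : List A) → (∀ x → x ∈ xs → f x ≡ g x) → sumL f xs ≡ sumL g xs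
  sumL-ext∈ []       e = refl
  sumL-ext∈ (x ∷ xs) e = cong₂ _+_ (e x (here refl)) (sumL-ext∈ xs (λ y y∈ → e y (there y∈)))

  sumL-ext : {f g : A → ℕ} → (∀ x → f x ≡ g x) → (xs : List A) → sumL f xs ≡ sumL g xs
  sumL-ext e xs = sumL-ext∈ xs (λ x _ → e x)

  sumL-mono∈ : {f g : A → ℕ} (xs : List A) → (∀ x → x ∈ xs → f x ≤ g x) → sumL f xs ≤ sumL g xs
  sumL-mono∈ []       e = z≤n
  sumL-mono∈ (x ∷ xs) e = +-mono-≤ (e x (here refl)) (sumL-mono∈ xs (λ y y∈ → e y (there y∈)))

  sumL-mono : {f g : A → ℕ} → (∀ x → f x ≤ g x) → (xs : List A) → sumL f xs ≤ sumL g xs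
  sumL-mono e xs = sumL-mono∈ xs (λ x _ → e x)

  sumL-+ : (f g : A → ℕ) (xs : List A) → sumL (λ x → f x + g x) xs ≡ sumL f xs + sumL g xs
  sumL-+ f g []       = refl
  sumL-+ f g (x ∷ xs) rewrite sumL-+ f g xs = interchange (f x) (g x) (sumL f xs) (sumL g xs)

  sumL-*ʳ : (a : ℕ) (f : A → ℕ) (xs : List A) → sumL (λ x → f x * a) xs ≡ sumL f xs * a
  sumL-*ʳ a f []       = refl
  sumL-*ʳ a f (x ∷ xs) = trans (cong (λ w → f x * a + w) (sumL-*ʳ a f xs)) (sym (*-distribʳ-+ a (f x) _))

  sumL-bound : {f : A → ℕ} (B : ℕ) (xs : List A) → (∀ x → x ∈ xs → f x ≤ B) → sumL f xs ≤ length xs * B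
  sumL-bound B []       e = z≤n
  sumL-bound B (x ∷ xs) e = +-mono-≤ (e x (here refl)) (sumL-bound B xs (λ y y∈ → e y (there y∈)))

  sumL-≥ : (f : A → ℕ) {x : A} {xs : List A} → x ∈ xs → f x ≤ sumL f xs
  sumL-≥ f {xs = y ∷ xs} (here refl) = m≤m+n (f y) _
  sumL-≥ f {xs = y ∷ xs} (there p)   = ≤-trans (sumL-≥ f p) (m≤n+m _ (f y))

module _ {A B : Set} where

  sumL-map : (f : B → ℕ) (h : A → B) (xs : List A) → sumL f (map h xs) ≡ sumL (f ∘ h) xs
  sumL-map f h []       = refl
  sumL-map f h (x ∷ xs) = cong (λ w → f (h x) + w) (sumL-map f h xs)

  sumL-concatMap : (f : B → ℕ) (g : A → List B) (xs : List A) →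
    sumL f (concatMap g xs) ≡ sumL (λ x → sumL f (g x)) xs
  sumL-concatMap f g []       = refl
  sumL-concatMap f g (x ∷ xs) =
    trans (sumL-++ f (g x) (concatMap g xs)) (cong (λ w → sumL f (g x) + w) (sumL-concatMap f g xs))

  sumL-swap : (h : A → B → ℕ) (xs : List A) (ys : List B) →
    sumL (λ y → sumL (λ x → h x y) xs) ys ≡ sumL (λ x → sumL (λ y → h x y) ys) xs
  sumL-swap h xs []       = sym (sumL-zero xs)
    where
    sumL-zero : (zs : List A) → sumL (λ _ → 0) zs ≡ 0
    sumL-zero []       = refl
    sumL-zero (z ∷ zs) = sumL-zero zs
  sumL-swap h xs (y ∷ ys) = trans (cong (λ w → sumL (λ x → h x y) xs + w) (sumL-swap h xs ys))
                                  (sym (sumL-+ (λ x → h x y) (λ x → sumL (λ y → h x y) ys) xs))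

sumL-allFin : ∀ n (f : Fin n → ℕ) → sumL f (allFin n) ≡ sumF f
sumL-allFin n f = tab f (λ x → x)
  where
  tab : ∀ {A : Set} {n} (f : A → ℕ) (g : Fin n → A) → sumL f (tabulate g) ≡ sumF (f ∘ g)
  tab {n = zero}  f g = refl
  tab {n = suc n} f g = cong (λ w → f (g fz) + w) (tab f (g ∘ fs))

sumF-ext : ∀ {n} {f g : Fin n → ℕ} → (∀ x → f x ≡ g x) → sumF f ≡ sumF g
sumF-ext {zero}  e = refl
sumF-ext {suc n} e = cong₂ _+_ (e fz) (sumF-ext (e ∘ fs))

sumF-mono : ∀ {n} {f g : Fin n → ℕ} → (∀ x → f x ≤ g x) → sumF f ≤ sumF g
sumF-mono {zero}  e = z≤n
sumF-mono {suc n} e = +-mono-≤ (e fz) (sumF-mono (e ∘ fs))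

sumF-const : ∀ n (a : ℕ) → sumF {n} (λ _ → a) ≡ n * a
sumF-const zero    a = refl
sumF-const (suc n) a = cong (λ w → a + w) (sumF-const n a)

sumF-zero : ∀ {n} (f : Fin n → ℕ) → (∀ y → f y ≡ 0) → sumF f ≡ 0
sumF-zero {zero}  f h = refl
sumF-zero {suc n} f h rewrite h fz = sumF-zero (f ∘ fs) (h ∘ fs)

count-by-first : ∀ {m} {B C : Set} (_∷′_ : Fin m → B → C) (p : C → Bool) (rest : List B) →
  count p (concatMap (λ x → map (x ∷′_) rest) (allFin m)) ≡ sumF (λ y → count (λ c → p (y ∷′ c)) rest)
count-by-first {m} _∷′_ p rest =
  trans (count-sum p (concatMap (λ x → map (x ∷′_) rest) (allFin m)))
  (trans (sumL-concatMap (ind ∘ p) (λ x → map (x ∷′_) rest) (allFin m))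
  (trans (sumL-ext (λ y → trans (sumL-map (ind ∘ p) (y ∷′_) rest) (sym (count-sum (λ c → p (y ∷′ c)) rest))) (allFin m))
  (sumL-allFin m _)))

eqᵇ : ∀ {n} → Fin n → Fin n → Bool
eqᵇ x y = ⌊ x ≟ᶠ y ⌋

eqᵇ-refl : ∀ {n} (x : Fin n) → eqᵇ x x ≡ true
eqᵇ-refl x with x ≟ᶠ x
... | yes _  = refl
... | no x≢x = ⊥-elim (x≢x refl)

eqᵇ-true : ∀ {n} {x y : Fin n} → eqᵇ x y ≡ true → x ≡ y
eqᵇ-true {x = x} {y} e with x ≟ᶠ y
... | yes x≡y = x≡y

eqᵇ-false : ∀ {n} {x y : Fin n} → ¬ (x ≡ y) → eqᵇ x y ≡ false
eqᵇ-false {x = x} {y} x≢y with x ≟ᶠ y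
... | yes x≡y = ⊥-elim (x≢y x≡y)
... | no _    = refl

eqᵇ-false⁻ : ∀ {n} {x y : Fin n} → eqᵇ x y ≡ false → ¬ (x ≡ y)
eqᵇ-false⁻ {x = x} e refl rewrite eqᵇ-refl x = case e of λ ()

eqᵇ-suc : ∀ {n} (y x : Fin n) → eqᵇ (fs y) (fs x) ≡ eqᵇ y x
eqᵇ-suc y x = ⌊⌋-map′ (cong fs) Finₚ.suc-injective (y ≟ᶠ x)

sumF-point : ∀ {n} (x : Fin n) (a : ℕ) → sumF (λ y → ind (eqᵇ y x) * a) ≡ a
sumF-point {suc n} fz a =
  trans (cong (λ w → (a + 0) + w) (sumF-zero {n} (λ y → ind (eqᵇ (fs y) fz) * a)
                                     (λ y → cong (λ b → ind b * a) (eqᵇ-false {x = fs y} {y = fz} (λ ())))))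
        (trans (+-identityʳ (a + 0)) (+-identityʳ a))
sumF-point {suc n} (fs x) a =
  trans (sumF-ext (λ y → cong (λ b → ind b * a) (eqᵇ-suc y x))) (sumF-point x a)

module _ {A : Set} where

  count-ext : {p q : A → Bool} → (∀ x → p x ≡ q x) → (xs : List A) → count p xs ≡ count q xs
  count-ext {p} {q} e xs =
    trans (count-sum p xs) (trans (sumL-ext (cong ind ∘ e) xs) (sym (count-sum q xs)))

  count-∧ : (b : Bool) (q : A → Bool) (xs : List A) → count (λ x → b ∧ q x) xs ≡ ind b * count q xs
  count-∧ true  q xs       = sym (+-identityʳ _)
  count-∧ false q []       = refl
  count-∧ false q (x ∷ xs) = count-∧ false q xs

  count-≤ : {p q : A → Bool} → (∀ x → p x ≡ true → q x ≡ true) → (xs : List A) → count p xs ≤ count q xs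
  count-≤ p⇒q [] = z≤n
  count-≤ {p} {q} p⇒q (x ∷ xs) with p x in px | q x in qx
  ... | true  | true  = s≤s (count-≤ p⇒q xs)
  ... | true  | false = case trans (sym (p⇒q x px)) qx of λ ()
  ... | false | true  = m≤n⇒m≤1+n (count-≤ p⇒q xs)
  ... | false | false = count-≤ p⇒q xs

  count-false : {p : A → Bool} → (∀ x → p x ≡ false) → (xs : List A) → count p xs ≡ 0
  count-false h []           = refl
  count-false {p} h (x ∷ xs) rewrite h x = count-false h xs

  count-≥1 : (p : A → Bool) {x : A} {xs : List A} → x ∈ xs → p x ≡ true → 1 ≤ count p xs
  count-≥1 p {xs = y ∷ xs} (here refl) e rewrite e = s≤s z≤n
  count-≥1 p {xs = y ∷ xs} (there q) e with p y
  ... | true  = s≤s z≤n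
  ... | false = count-≥1 p q e

  count-witness : (p : A → Bool) (xs : List A) → 1 ≤ count p xs → Σ A λ x → x ∈ xs × p x ≡ true
  count-witness p (x ∷ xs) c with p x in eq
  ... | true  = x , here refl , eq
  ... | false = let (y , y∈ , e) = count-witness p xs c in y , there y∈ , e

  count-split : (p q : A → Bool) (xs : List A) →
    count p xs ≤ count (λ x → p x ∧ not (q x)) xs + count q xs
  count-split p q [] = z≤n
  count-split p q (x ∷ xs) with p x | q x
  ... | true  | true  = subst (suc (count p xs) ≤_) (sym (+-suc _ _)) (s≤s (count-split p q xs))
  ... | true  | false = s≤s (count-split p q xs)
  ... | false | true  = subst (count p xs ≤_) (sym (+-suc _ _)) (m≤n⇒m≤1+n (count-split p q xs))
  ... | false | false = count-split p q xs

  count-compl : (p : A → Bool) (xs : List A) → count p xs + count (not ∘ p) xs ≡ length xs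
  count-compl p [] = refl
  count-compl p (x ∷ xs) with p x
  ... | true  = cong suc (count-compl p xs)
  ... | false = trans (+-suc _ _) (cong suc (count-compl p xs))

  any-false : (p : A → Bool) {x : A} {xs : List A} → any p xs ≡ false → x ∈ xs → p x ≡ false
  any-false p {xs = y ∷ xs} e (here refl) with p y
  ... | false = refl
  any-false p {xs = y ∷ xs} e (there q) with p y
  ... | false = any-false p e q

  any-true : (p : A → Bool) {x : A} {xs : List A} → x ∈ xs → p x ≡ true → any p xs ≡ true
  any-true p {xs = y ∷ xs} (here refl) e rewrite e = refl
  any-true p {xs = y ∷ xs} (there q) e with p y
  ... | true  = refl
  ... | false = any-true p q e

  any-true⁻ : (p : A → Bool) (xs : List A) → any p xs ≡ true → Σ A λ x → x ∈ xs × p x ≡ true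
  any-true⁻ p (y ∷ xs) e with p y in eq
  ... | true  = y , here refl , eq
  ... | false = let (z , z∈ , e') = any-true⁻ p xs e in z , there z∈ , e'

  all-true : (p : A → Bool) {x : A} {xs : List A} → all p xs ≡ true → x ∈ xs → p x ≡ true
  all-true p {xs = y ∷ xs} e (here refl) with p y
  ... | true = refl
  all-true p {xs = y ∷ xs} e (there q) with p y
  ... | true = all-true p e q

  all-true⁺ : (p : A → Bool) (xs : List A) → (∀ x → x ∈ xs → p x ≡ true) → all p xs ≡ true
  all-true⁺ p []       h = refl
  all-true⁺ p (y ∷ xs) h rewrite h y (here refl) = all-true⁺ p xs (λ x x∈ → h x (there x∈))

  all-false : (p : A → Bool) {x : A} {xs : List A} → x ∈ xs → p x ≡ false → all p xs ≡ false
  all-false p {xs = y ∷ xs} (here refl) e rewrite e = refl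
  all-false p {xs = y ∷ xs} (there q) e with p y
  ... | false = refl
  ... | true  = all-false p q e

  all-false⁻ : (p : A → Bool) (xs : List A) → all p xs ≡ false → Σ A λ x → x ∈ xs × p x ≡ false
  all-false⁻ p (y ∷ xs) e with p y in eq
  ... | false = y , here refl , eq
  ... | true  = let (z , z∈ , e') = all-false⁻ p xs e in z , there z∈ , e'

module _ {A B : Set} where

  count-swap : (R : A → B → Bool) (xs : List A) (ys : List B) →
    sumL (λ x → count (R x) ys) xs ≡ sumL (λ y → count (λ x → R x y) xs) ys
  count-swap R xs ys = trans (sumL-ext (λ x → count-sum (R x) ys) xs)
    (trans (sym (sumL-swap (λ x y → ind (R x y)) xs ys))
    (sumL-ext (λ y → sym (count-sum (λ x → R x y) xs)) ys))

  union-bound : (R : A → B → Bool) (is : List A) (Q : B → Bool) (ys : List B) →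
    (∀ y → Q y ≡ true → Σ A λ i → i ∈ is × R i y ≡ true) →
    count Q ys ≤ sumL (λ i → count (R i) ys) is
  union-bound R is Q ys cover =
    ≤-trans (≤-reflexive (count-sum Q ys))
    (≤-trans (sumL-mono pointwise ys)
    (≤-reflexive (trans (sumL-swap (λ i y → ind (R i y)) is ys) (sumL-ext (λ i → sym (count-sum (R i) ys)) is))))
    where
    pointwise : ∀ y → ind (Q y) ≤ sumL (λ i → ind (R i y)) is
    pointwise y with Q y in e
    ... | false = z≤n
    ... | true with cover y e
    ... | i , i∈ , r = subst (λ b → ind b ≤ sumL (λ i → ind (R i y)) is) r (sumL-≥ (λ i → ind (R i y)) i∈)

size : ∀ {n} → (Fin n → Bool) → ℕ
size A = sumF (ind ∘ A)

size-ext : ∀ {n} {A B : Fin n → Bool} → (∀ x → A x ≡ B x) → size A ≡ size B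
size-ext e = sumF-ext (cong ind ∘ e)

size-compl : ∀ {n} (A : Fin n → Bool) → size A + size (not ∘ A) ≡ n
size-compl {zero}  A = refl
size-compl {suc n} A with A fz
... | true  = cong suc (size-compl (A ∘ fs))
... | false = trans (+-suc _ _) (cong suc (size-compl (A ∘ fs)))

size-≤ : ∀ {n} (A : Fin n → Bool) → size A ≤ n
size-≤ A = subst (size A ≤_) (size-compl A) (m≤m+n _ _)

size-insert : ∀ {n} (x : Fin n) (B : Fin n → Bool) → B x ≡ false →
  size (λ i → eqᵇ i x ∨ B i) ≡ suc (size B)
size-insert {suc n} fz B e rewrite e =
  cong suc (size-ext {A = λ i → eqᵇ (fs i) fz ∨ B (fs i)} (λ i → refl))
size-insert {suc n} (fs x) B e with B fz
... | true  = cong suc (trans (size-ext shift) (size-insert x (B ∘ fs) e))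
  where shift = λ i → cong (_∨ B (fs i)) (eqᵇ-suc i x)
... | false = trans (size-ext shift) (size-insert x (B ∘ fs) e)
  where shift = λ i → cong (_∨ B (fs i)) (eqᵇ-suc i x)

size-strict : ∀ {n} (A B : Fin n → Bool) (x : Fin n) → (∀ i → A i ≡ true → B i ≡ true) →
  B x ≡ true → A x ≡ false → suc (size A) ≤ size B
size-strict {suc n} A B fz A⊆B bx ax rewrite bx | ax =
  s≤s (sumF-mono (λ i → ind-mono (A⊆B (fs i))))
size-strict {suc n} A B (fs x) A⊆B bx ax =
  subst (_≤ ind (B fz) + size (B ∘ fs)) (+-suc _ _)
        (+-mono-≤ (ind-mono (A⊆B fz)) (size-strict (A ∘ fs) (B ∘ fs) x (A⊆B ∘ fs) bx ax))

memb : ∀ {n} → List (Fin n) → Fin n → Bool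
memb L x = any (eqᵇ x) L

memb→∈ : ∀ {n} {x : Fin n} {L} → memb L x ≡ true → x ∈ L
memb→∈ {x = x} {L} e = let (y , y∈ , q) = any-true⁻ (eqᵇ x) L e in subst (_∈ L) (sym (eqᵇ-true q)) y∈

∈→memb : ∀ {n} {x : Fin n} {L} → x ∈ L → memb L x ≡ true
∈→memb {x = x} p = any-true (eqᵇ x) p (eqᵇ-refl x)

mult : ∀ {n} → Fin n → List (Fin n) → ℕ
mult x L = count (eqᵇ x) L

mult-++ : ∀ {n} (x : Fin n) L M → mult x (L ++ M) ≡ mult x L + mult x M
mult-++ x L M = trans (count-sum (eqᵇ x) (L ++ M))
  (trans (sumL-++ _ L M) (sym (cong₂ _+_ (count-sum (eqᵇ x) L) (count-sum (eqᵇ x) M))))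

mult-head : ∀ {n} (y : Fin n) L → mult y (y ∷ L) ≡ suc (mult y L)
mult-head y L rewrite eqᵇ-refl y = refl

mult-absent : ∀ {n} {x : Fin n} L → memb L x ≡ false → mult x L ≡ 0
mult-absent []      e = refl
mult-absent {x = x} (y ∷ L) e with eqᵇ x y
... | false = mult-absent L e

distinct-head : ∀ {n} (x : Fin n) L → distinct (x ∷ L) ≡ true → memb L x ≡ false
distinct-head x L e = not-true (proj₁ (∧-elim {not (memb L x)} e))

distinct-tail : ∀ {n} (x : Fin n) L → distinct (x ∷ L) ≡ true → distinct L ≡ true
distinct-tail x L e = proj₂ (∧-elim {not (memb L x)} e)

-- a list is distinct iff every vertex occurs at most once; this
-- characterisation is invariant under rearranging the list
distinct→mult : ∀ {n} (L : List (Fin n)) → distinct L ≡ true → ∀ x → mult x L ≤ 1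
distinct→mult []      d x = z≤n
distinct→mult (y ∷ L) d x with eqᵇ x y in e
... | true rewrite eqᵇ-true e | mult-absent L (distinct-head y L d) = s≤s z≤n
... | false = distinct→mult L (distinct-tail y L d) x

mult→distinct : ∀ {n} (L : List (Fin n)) → (∀ x → mult x L ≤ 1) → distinct L ≡ true
mult→distinct []      h = refl
mult→distinct (y ∷ L) h = ∧-intro y∉L (mult→distinct L (λ x → ≤-trans (mult-tail x) (h x)))
  where
  mult-tail : ∀ x → mult x L ≤ mult x (y ∷ L)
  mult-tail x with eqᵇ x y
  ... | true  = n≤1+n _
  ... | false = ≤-refl
  y∉L : not (memb L y) ≡ true
  y∉L with memb L y in e
  ... | false = refl
  ... | true  = ⊥-elim (1+n≰n (≤-trans (s≤s (count-≥1 (eqᵇ y) (memb→∈ {L = L} e) (eqᵇ-refl y)))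
                                        (subst (_≤ 1) (mult-head y L) (h y))))

size-memb : ∀ {n} (L : List (Fin n)) → distinct L ≡ true → size (memb L) ≡ length L
size-memb {n} [] d = sumF-zero {n} (λ _ → 0) (λ _ → refl)
size-memb (y ∷ L) d =
  trans (size-insert y (memb L) (distinct-head y L d)) (cong suc (size-memb L (distinct-tail y L d)))

free : ∀ {n} → List (Fin n) → ℕ
free L = size (not ∘ memb L)

free-+-length : ∀ {n} (L : List (Fin n)) → distinct L ≡ true → free L + length L ≡ n
free-+-length L d =
  trans (+-comm (free L) _) (subst (λ z → z + free L ≡ _) (size-memb L d) (size-compl (memb L)))

distinct-length : ∀ {n} (L : List (Fin n)) → distinct L ≡ true → length L ≤ n
distinct-length L d = subst (_≤ _) (size-memb L d) (size-≤ (memb L))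

same-length-⊆ : ∀ {n} (A B : List (Fin n)) → distinct A ≡ true → distinct B ≡ true →
  length A ≡ length B → (∀ y → y ∈ A → y ∈ B) → ∀ y → y ∈ B → y ∈ A
same-length-⊆ A B dA dB lenEq A⊆B y y∈B with memb A y in e
... | true  = memb→∈ {L = A} e
... | false = ⊥-elim (1+n≰n (subst₂ (λ a b → suc a ≤ b) (trans (size-memb A dA) lenEq) (size-memb B dB)
                (size-strict (memb A) (memb B) y (λ i a → ∈→memb (A⊆B i (memb→∈ {L = A} a))) (∈→memb y∈B) e)))

Colouring : ℕ → ℕ → Set
Colouring n k = Vec (Fin k) n

count-all-colourings : ∀ k n → length (vecs k n) ≡ k ^ n
count-all-colourings k n = trans (sym (count-true (vecs k n))) (count-true-vecs n)
  where
  count-true : ∀ {A : Set} (xs : List A) → count (λ _ → true) xs ≡ length xs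
  count-true []       = refl
  count-true (x ∷ xs) = cong suc (count-true xs)
  count-true-vecs : ∀ j → count (λ _ → true) (vecs k j) ≡ k ^ j
  count-true-vecs zero    = refl
  count-true-vecs (suc j) = trans (count-by-first _∷ᵥ_ (λ _ → true) (vecs k j))
    (trans (sumF-ext {k} (λ _ → count-true-vecs j)) (sumF-const k _))

agrees : ∀ {n k} → (Fin n → Bool) → (Fin n → Fin k) → Colouring n k → Bool
agrees {zero}  A f []ᵥ       = true
agrees {suc n} A f (y ∷ᵥ c) = (not (A fz) ∨ eqᵇ y (f fz)) ∧ agrees (A ∘ fs) (f ∘ fs) c

agrees-sound : ∀ {n k} (A : Fin n → Bool) (f : Fin n → Fin k) (c : Colouring n k) →
  agrees A f c ≡ true → ∀ i → A i ≡ true → lookup c i ≡ f i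
agrees-sound {suc n} A f (y ∷ᵥ c) e fz a with ∧-elim {not (A fz) ∨ eqᵇ y (f fz)} e
... | head-ok , _ rewrite a = eqᵇ-true head-ok
agrees-sound {suc n} A f (y ∷ᵥ c) e (fs i) a with ∧-elim {not (A fz) ∨ eqᵇ y (f fz)} e
... | _ , tail-ok = agrees-sound (A ∘ fs) (f ∘ fs) c tail-ok i a

agrees-complete : ∀ {n k} (A : Fin n → Bool) (f : Fin n → Fin k) (c : Colouring n k) →
  (∀ i → A i ≡ true → lookup c i ≡ f i) → agrees A f c ≡ true
agrees-complete {zero}  A f []ᵥ       h = refl
agrees-complete {suc n} A f (y ∷ᵥ c) h = ∧-intro head-ok (agrees-complete (A ∘ fs) (f ∘ fs) c (h ∘ fs))
  where
  head-ok : not (A fz) ∨ eqᵇ y (f fz) ≡ true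
  head-ok with A fz in e
  ... | false = refl
  ... | true rewrite h fz e = eqᵇ-refl (f fz)

count-agrees : ∀ {k} n (A : Fin n → Bool) (f : Fin n → Fin k) →
  count (agrees A f) (vecs k n) ≡ k ^ size (not ∘ A)
count-agrees zero A f = refl
count-agrees {k} (suc n) A f =
  trans (count-by-first _∷ᵥ_ (agrees A f) (vecs k n))
  (trans (sumF-ext (λ y → count-∧ (not (A fz) ∨ eqᵇ y (f fz)) (agrees (A ∘ fs) (f ∘ fs)) (vecs k n)))
  (trans (cong (λ z → sumF (λ y → ind (not (A fz) ∨ eqᵇ y (f fz)) * z)) (count-agrees n (A ∘ fs) (f ∘ fs)))
  (vertex0 (A fz))))
  where
  X = k ^ size (not ∘ A ∘ fs)
  vertex0 : (b : Bool) → sumF (λ y → ind (not b ∨ eqᵇ y (f fz)) * X) ≡ k ^ (ind (not b) + size (not ∘ A ∘ fs))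
  vertex0 true  = sumF-point (f fz) X
  vertex0 false = trans (sumF-const k (X + 0)) (cong (k *_) (+-identityʳ X))

mono : ∀ {n k} → List (Fin n) → Colouring n k → Bool
mono L c = monochromatic (lookup c) L

mono-sound : ∀ {n k} (L : List (Fin n)) (c : Colouring n k) → mono L c ≡ true →
  ∀ {y z} → y ∈ L → z ∈ L → lookup c y ≡ lookup c z
mono-sound (x ∷ L) c e p q = trans (to-head p) (sym (to-head q))
  where
  to-head : ∀ {w} → w ∈ x ∷ L → lookup c w ≡ lookup c x
  to-head (here refl) = refl
  to-head (there r)   = sym (eqᵇ-true (all-true (λ y → eqᵇ (lookup c x) (lookup c y)) e r))

mono-complete : ∀ {n k} (L : List (Fin n)) (c : Colouring n k) →
  (∀ {y z} → y ∈ L → z ∈ L → lookup c y ≡ lookup c z) → mono L c ≡ true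
mono-complete []      c h = refl
mono-complete (x ∷ L) c h =
  all-true⁺ _ L (λ y y∈ → subst (λ w → eqᵇ (lookup c x) w ≡ true) (h (here refl) (there y∈)) (eqᵇ-refl _))

-- a colouring constant on x0 ∷ L is fixed by a colour for the whole list
-- and free outside: k * k ^ (number of vertices outside the list)
count-monochromatic : ∀ {n k} (x0 : Fin n) (L : List (Fin n)) →
  count (mono (x0 ∷ L)) (vecs k n) ≡ k * k ^ free (x0 ∷ L)
count-monochromatic {n} {k} x0 L =
  trans (count-sum (mono C) V)
  (trans (sumL-ext by-colour V)
  (trans (swap-sums V)
  (trans (sumF-ext (λ x → trans (sym (count-sum _ V)) (count-agrees n (memb C) (λ _ → x))))
  (sumF-const k _))))
  where
  C = x0 ∷ L
  V = vecs k n
  swap-sums : (xs : List (Colouring n k)) →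
    sumL (λ c → sumF (λ x → ind (agrees (memb C) (λ _ → x) c))) xs ≡
    sumF (λ x → sumL (λ c → ind (agrees (memb C) (λ _ → x) c)) xs)
  swap-sums xs = trans (sumL-ext (λ c → sym (sumL-allFin k _)) xs)
                       (trans (sumL-swap (λ x c → ind (agrees (memb C) (λ _ → x) c)) (allFin k) xs) (sumL-allFin k _))
  -- c is constant on C iff it agrees with exactly one constant colour x
  by-colour : ∀ c → ind (mono C c) ≡ sumF (λ x → ind (agrees (memb C) (λ _ → x) c))
  by-colour c with mono C c in e
  ... | true = sym (trans (sumF-ext agree-iff-head) (sumF-point (lookup c x0) 1))
    where
    agree-iff-head : ∀ x → ind (agrees (memb C) (λ _ → x) c) ≡ ind (eqᵇ x (lookup c x0)) * 1
    agree-iff-head x with eqᵇ x (lookup c x0) in ex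
    ... | true rewrite eqᵇ-true ex =
      cong ind (agrees-complete _ _ c (λ i ai → mono-sound C c e (memb→∈ {L = C} ai) (here refl)))
    ... | false with agrees (memb C) (λ _ → x) c in ea
    ...   | false = refl
    ...   | true  = ⊥-elim (eqᵇ-false⁻ ex (sym (agrees-sound _ _ c ea x0 (∈→memb {L = C} (here refl)))))
  ... | false = sym (sumF-zero _ never)
    where
    never : ∀ x → ind (agrees (memb C) (λ _ → x) c) ≡ 0
    never x with agrees (memb C) (λ _ → x) c in ea
    ... | false = refl
    ... | true  = case trans (sym e) (mono-complete C c (λ p r →
                    trans (agrees-sound _ _ c ea _ (∈→memb p)) (sym (agrees-sound _ _ c ea _ (∈→memb r))))) of λ ()

-- colourings constant on each of two disjoint lists A and B: choose a colour
-- for each and colour the vertices outside B ++ A freely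
count-mono-two : ∀ {n k} (A B : List (Fin n)) (a : Fin n) (b : Fin n) → a ∈ A → b ∈ B →
  (∀ y → y ∈ B → memb A y ≡ false) →
  count (λ c → mono A c ∧ mono B c) (vecs k n) ≤ k * (k * k ^ free (B ++ A))
count-mono-two {n} {k} A B a b a∈ b∈ disjoint =
  ≤-trans (union-bound (λ xy c → agrees (memb (B ++ A)) (prescribe xy) c) pairs
             (λ c → mono A c ∧ mono B c) (vecs k n)
             (λ c m → (lookup c a , lookup c b) , pair∈ _ _ , agrees-complete _ _ c (forced c m)))
  (≤-reflexive (trans (sumL-ext (λ xy → count-agrees n (memb (B ++ A)) (prescribe xy)) pairs) (sum-pairs _)))
  where
  prescribe : Fin k × Fin k → Fin n → Fin k
  prescribe (x , y) i = if memb A i then x else y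
  forced : ∀ c → mono A c ∧ mono B c ≡ true → ∀ i → memb (B ++ A) i ≡ true →
    lookup c i ≡ prescribe (lookup c a , lookup c b) i
  forced c m i i∈ with ∧-elim {mono A c} m | ∈-++⁻ B (memb→∈ {L = B ++ A} i∈)
  ... | mA , mB | inj₁ i∈B rewrite disjoint i i∈B = mono-sound B c mB i∈B b∈
  ... | mA , mB | inj₂ i∈A rewrite ∈→memb {L = A} i∈A = mono-sound A c mA i∈A a∈
  pairs : List (Fin k × Fin k)
  pairs = concatMap (λ x → map (x ,_) (allFin k)) (allFin k)
  pair∈ : ∀ x y → (x , y) ∈ pairs
  pair∈ x y = ∈-concatMap⁺ (λ x → map (x ,_) (allFin k)) (Any.map (λ { refl → ∈-map⁺ (x ,_) (∈-allFin y) }) (∈-allFin x))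
  sum-colours : ∀ K → sumL (λ (_ : Fin k) → K) (allFin k) ≡ k * K
  sum-colours K = trans (sumL-allFin k (λ _ → K)) (sumF-const k K)
  sum-pairs : ∀ K → sumL (λ _ → K) pairs ≡ k * (k * K)
  sum-pairs K = trans (sumL-concatMap (λ _ → K) (λ x → map (x ,_) (allFin k)) (allFin k))
    (trans (sumL-ext (λ x → trans (sumL-map (λ _ → K) (x ,_) (allFin k)) (sum-colours K)) (allFin k)) (sum-colours (k * K)))

seqs-∈ : ∀ {n} (xs : List (Fin n)) → xs ∈ seqs n (length xs)
seqs-∈ [] = here refl
seqs-∈ {n} (x ∷ xs) = ∈-concatMap⁺ (λ y → map (y ∷_) (seqs n (length xs)))
  (Any.map (λ { refl → ∈-map⁺ (x ∷_) (seqs-∈ xs) }) (∈-allFin x))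

seqs-length : ∀ {n} l {xs : List (Fin n)} → xs ∈ seqs n l → length xs ≡ l
seqs-length zero (here refl) = refl
seqs-length {n} (suc l) p with Any.satisfied (∈-concatMap⁻ (λ y → map (y ∷_) (seqs n l)) {xs = allFin n} p)
... | y , q with ∈-map⁻ (y ∷_) q
... | ys , ys∈ , refl = cong suc (seqs-length l ys∈)

eqL : ∀ {n} → List (Fin n) → List (Fin n) → Bool
eqL xs ys = ⌊ ≡-dec _≟ᶠ_ xs ys ⌋

eqL-refl : ∀ {n} (xs : List (Fin n)) → eqL xs xs ≡ true
eqL-refl xs with ≡-dec _≟ᶠ_ xs xs
... | yes _  = refl
... | no ne = ⊥-elim (ne refl)

eqL-cons : ∀ {n} (y x : Fin n) ys xs → eqL (y ∷ ys) (x ∷ xs) ≡ eqᵇ y x ∧ eqL ys xs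
eqL-cons y x ys xs =
  trans (isYes≗does (≡-dec _≟ᶠ_ (y ∷ ys) (x ∷ xs)))
        (sym (cong₂ _∧_ (isYes≗does (y ≟ᶠ x)) (isYes≗does (≡-dec _≟ᶠ_ ys xs))))

seqs-unique : ∀ {n} l (xs : List (Fin n)) → count (λ ys → eqL ys xs) (seqs n l) ≤ 1
seqs-unique zero xs with eqL [] xs
... | true  = s≤s z≤n
... | false = z≤n
seqs-unique {n} (suc l) [] =
  ≤-trans (≤-reflexive (trans (count-by-first _∷_ (λ ys → eqL ys []) (seqs n l))
                     (sumF-zero {n} _ (λ y → count-false (λ _ → refl) (seqs n l))))) z≤n
seqs-unique {n} (suc l) (x ∷ xs) =
  ≤-trans (≤-reflexive (trans (count-by-first _∷_ (λ ys → eqL ys (x ∷ xs)) (seqs n l))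
    (trans (sumF-ext (λ y → trans (count-ext (λ c → eqL-cons y x c xs) (seqs n l)) (count-∧ (eqᵇ y x) _ (seqs n l))))
    (sumF-point x _))))
  (seqs-unique l xs)

minimum : ∀ {n} (x : Fin n) xs →
  Σ (Fin n) λ u → u ∈ x ∷ xs × (∀ y → y ∈ x ∷ xs → toℕ u ≤ toℕ y)
minimum x xs = argmin toℕ x xs , member , least
  where
  member : argmin toℕ x xs ∈ x ∷ xs
  member with argmin-sel toℕ x xs
  ... | inj₁ eq = here eq
  ... | inj₂ p  = there p
  least : ∀ y → y ∈ x ∷ xs → toℕ (argmin toℕ x xs) ≤ toℕ y
  least y (here refl) = f[argmin]≤f[⊤] {f = toℕ} x xs
  least y (there p)   = All.lookup (f[argmin]≤f[xs] {f = toℕ} x xs) p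

module Cycles {n} (D : Digraph n) where

  path : List (Fin n) → Bool
  path = pathEdges D

  closedWalk : List (Fin n) → Bool
  closedWalk []       = true
  closedWalk (x ∷ xs) = path (x ∷ xs ++ [ x ])

  path-snoc : ∀ x xs z → path (x ∷ xs ++ [ z ]) ≡ path (x ∷ xs) ∧ adj D (lastOr x xs) z
  path-snoc x []       z = ∧-identityʳ (adj D x z)
  path-snoc x (y ∷ ys) z = trans (cong (adj D x y ∧_) (path-snoc y ys z)) (sym (∧-assoc (adj D x y) _ _))

  path-split : ∀ xs y ys → path (xs ++ y ∷ ys) ≡ path (xs ++ [ y ]) ∧ path (y ∷ ys)
  path-split []            y ys = refl
  path-split (x ∷ [])      y ys = cong (_∧ path (y ∷ ys)) (sym (∧-identityʳ (adj D x y)))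
  path-split (x ∷ x' ∷ xs) y ys =
    trans (cong (adj D x x' ∧_) (path-split (x' ∷ xs) y ys)) (sym (∧-assoc (adj D x x') _ _))

  record Cycle (zs : List (Fin n)) : Set where
    field
      long     : 2 ≤ length zs
      simple   : distinct zs ≡ true
      closed   : closedWalk zs ≡ true
  open Cycle public

  isCycle→Cycle : ∀ zs → isCycle D zs ≡ true → Cycle zs
  isCycle→Cycle (x ∷ y ∷ ys) e with ∧-elim {distinct (x ∷ y ∷ ys)} e
  ... | d , r = record { long = s≤s (s≤s z≤n) ; simple = d ; closed = trans (path-snoc x (y ∷ ys) x) r }

  Cycle→isCycle : ∀ zs → Cycle zs → isCycle D zs ≡ true
  Cycle→isCycle []           c with long c
  ... | ()
  Cycle→isCycle (x ∷ [])     c with long c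
  ... | s≤s ()
  Cycle→isCycle (x ∷ y ∷ ys) c = ∧-intro (simple c) (trans (sym (path-snoc x (y ∷ ys) x)) (closed c))

  closed-edge : ∀ pre a b rest → closedWalk (pre ++ a ∷ b ∷ rest) ≡ true → adj D a b ≡ true
  closed-edge []        a b rest e = proj₁ (∧-elim {adj D a b} e)
  closed-edge (p ∷ pre) a b rest e =
    proj₁ (∧-elim {adj D a b} (proj₂ (∧-elim {path ((p ∷ pre) ++ [ a ])}
      (trans (sym (path-split (p ∷ pre) a (b ∷ rest ++ [ p ])))
             (trans (cong (λ z → path (p ∷ z)) (sym (++-assoc pre (a ∷ b ∷ rest) [ p ]))) e)))))

  rotate-length : ∀ (as : List (Fin n)) u bs → length (u ∷ bs ++ as) ≡ length (as ++ u ∷ bs)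
  rotate-length as u bs = length-++-comm (u ∷ bs) as

  rotate-closed : ∀ (as : List (Fin n)) u bs → closedWalk (as ++ u ∷ bs) ≡ true → closedWalk (u ∷ bs ++ as) ≡ true
  rotate-closed []       u bs e rewrite ++-identityʳ bs = e
  rotate-closed (a ∷ as) u bs e =
    trans (cong path (++-assoc (u ∷ bs) (a ∷ as) [ u ]))
    (trans (path-split (u ∷ bs) a (as ++ [ u ]))
    (trans (∧-comm (path ((u ∷ bs) ++ [ a ])) _)
    (trans (sym (path-split (a ∷ as) u (bs ++ [ a ])))
    (trans (sym (cong path (++-assoc (a ∷ as) (u ∷ bs) [ a ]))) e))))

  rotate : ∀ (as : List (Fin n)) u bs → Cycle (as ++ u ∷ bs) → Cycle (u ∷ bs ++ as)
  rotate as u bs c = record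
    { long     = subst (2 ≤_) (sym (rotate-length as u bs)) (long c)
    ; simple   = mult→distinct (u ∷ bs ++ as) (λ x → subst (_≤ 1) (sym (mult-rotate x))
                   (distinct→mult (as ++ u ∷ bs) (simple c) x))
    ; closed   = rotate-closed as u bs (closed c) }
    where
    mult-rotate : ∀ x → mult x (u ∷ bs ++ as) ≡ mult x (as ++ u ∷ bs)
    mult-rotate x = trans (mult-++ x (u ∷ bs) as)
                          (trans (+-comm (mult x (u ∷ bs)) (mult x as)) (sym (mult-++ x as (u ∷ bs))))

  rotate-∈ : ∀ (as : List (Fin n)) u bs {y} → y ∈ u ∷ bs ++ as → y ∈ as ++ u ∷ bs
  rotate-∈ as u bs (here refl) = ∈-++⁺ʳ as (here refl)
  rotate-∈ as u bs (there p) with ∈-++⁻ bs p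
  ... | inj₁ q = ∈-++⁺ʳ as (there q)
  ... | inj₂ q = ∈-++⁺ˡ q

  rotate-∈⁻ : ∀ (as : List (Fin n)) u bs {y} → y ∈ as ++ u ∷ bs → y ∈ u ∷ bs ++ as
  rotate-∈⁻ as u bs p with ∈-++⁻ as p
  ... | inj₁ q         = there (∈-++⁺ʳ bs q)
  ... | inj₂ (here refl) = here refl
  ... | inj₂ (there q) = there (∈-++⁺ˡ q)

  NoCycleBelow : ℕ → Set
  NoCycleBelow G = ∀ l → l < G → hasCycleOfLength D l ≡ false

  no-cycle-below : ∀ {G} zs → NoCycleBelow G → Cycle zs → length zs < G → ⊥
  no-cycle-below zs noShort c lt =
    case trans (sym (any-false (isCycle D) (noShort (length zs) lt) (seqs-∈ zs))) (Cycle→isCycle zs c) of λ ()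

  -- A shortest cycle has no chord: an edge from u to a vertex w of the cycle
  -- u ∷ zs can only go to the successor of u, otherwise
  -- w ∷ (rest of the cycle after w) ∷ u would be a shorter cycle.
  chordless : ∀ u zs w → Cycle (u ∷ zs) → w ∈ zs → adj D u w ≡ true →
    NoCycleBelow (length (u ∷ zs)) → Σ (List (Fin n)) λ rest → zs ≡ w ∷ rest
  chordless u zs w c w∈ uw noShort with ∈-∃++ w∈
  ... | []     , qs , eq     = qs , eq
  ... | p ∷ ps , qs , refl = ⊥-elim (no-cycle-below Z noShort cZ shorter)
    where
    Z = w ∷ qs ++ [ u ]
    L = p ∷ ps ++ w ∷ qs
    path-w-u : path (w ∷ qs ++ [ u ]) ≡ true
    path-w-u = proj₂ (∧-elim {path ((u ∷ p ∷ ps) ++ [ w ])}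
      (trans (sym (path-split (u ∷ p ∷ ps) w (qs ++ [ u ])))
             (trans (cong (λ z → path (u ∷ z)) (sym (++-assoc (p ∷ ps) (w ∷ qs) [ u ]))) (closed c))))
    mult-Z : ∀ x → mult x Z ≤ mult x (u ∷ L)
    mult-Z x = subst₂ _≤_ (sym (mult-++ x (w ∷ qs) [ u ]))
      (sym (trans (mult-++ x [ u ] L) (cong (λ t → mult x [ u ] + t) (mult-++ x (p ∷ ps) (w ∷ qs)))))
      (subst (_≤ mult x [ u ] + (mult x (p ∷ ps) + mult x (w ∷ qs))) (+-comm (mult x [ u ]) _)
             (+-monoʳ-≤ (mult x [ u ]) (m≤n+m _ _)))
    cZ : Cycle Z
    cZ = record
      { long     = s≤s (subst (1 ≤_) (sym (length-++ qs)) (m≤n+m 1 (length qs)))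
      ; simple   = mult→distinct Z (λ x → ≤-trans (mult-Z x) (distinct→mult (u ∷ L) (simple c) x))
      ; closed   = trans (cong (λ z → path (w ∷ z)) (++-assoc qs [ u ] [ w ]))
                         (trans (path-split (w ∷ qs) u [ w ]) (∧-intro path-w-u (trans (∧-identityʳ _) uw))) }
    shorter : length Z < length (u ∷ L)
    shorter = s≤s (subst₂ _<_ (sym (length-++ qs)) (sym (length-++ (p ∷ ps)))
                (s≤s (subst (_≤ length ps + suc (length qs)) (+-comm 1 (length qs)) (m≤n+m _ (length ps)))))

  canonical-rotation : ∀ zs → Cycle zs →
    Σ (List (Fin n)) λ R → Cycle R × startsAtMin R ≡ true × length R ≡ length zs × (∀ y → y ∈ R → y ∈ zs)
  canonical-rotation []       c with long c
  ... | ()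
  canonical-rotation (x ∷ xs) c with minimum x xs
  ... | u , u∈ , least with ∈-∃++ u∈
  ... | as , bs , eq =
    (u ∷ bs ++ as) , rotate as u bs (subst Cycle eq c)
    , all-true⁺ _ (bs ++ as) (λ y y∈ → T⇒≡true (≤⇒≤ᵇ (least y (subst (y ∈_) (sym eq) (rotate-∈ as u bs (there y∈))))))
    , trans (rotate-length as u bs) (cong length (sym eq))
    , λ y y∈ → subst (y ∈_) (sym eq) (rotate-∈ as u bs y∈)

  starts-at-min : ∀ {a b : Fin n} {bs} → startsAtMin (b ∷ bs) ≡ true → a ∈ b ∷ bs → toℕ b ≤ toℕ a
  starts-at-min s (here refl) = ≤-refl
  starts-at-min {a} {b} s (there p) =
    ≤ᵇ⇒≤ (toℕ b) (toℕ a) (≡true⇒T (all-true (λ y → toℕ b ≤ᵇ toℕ y) s p))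

  -- Two shortest cycles through the same vertices that agree up to some
  -- vertex l agree afterwards: by chordlessness the successor of l in the
  -- second cycle is its successor in the first.
  agree-after : ∀ {C C'} → Cycle C → Cycle C' → NoCycleBelow (length C) → (∀ y → y ∈ C' → y ∈ C) →
    ∀ R R' (pre : List (Fin n)) (l : Fin n) → C ≡ pre ++ l ∷ R → C' ≡ pre ++ l ∷ R' →
    length R ≡ length R' → R ≡ R'
  agree-after cC cC' noShort C'⊆C []      []       pre l e e' le = refl
  agree-after {C} {C'} cC cC' noShort C'⊆C (x ∷ R) (y ∷ R') pre l e e' le
    with chordless l ((x ∷ R) ++ pre) y rotated y-after-l l→y noShort′
    where
    rotated = rotate pre l (x ∷ R) (subst Cycle e cC)
    l→y = closed-edge pre l y R' (subst (λ z → closedWalk z ≡ true) e' (closed cC'))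
    noShort′ : NoCycleBelow (length (l ∷ (x ∷ R) ++ pre))
    noShort′ = subst NoCycleBelow (trans (cong length e) (sym (rotate-length pre l (x ∷ R)))) noShort
    y-after-l : y ∈ (x ∷ R) ++ pre
    y-after-l with rotate-∈⁻ pre l (x ∷ R) (subst (y ∈_) e (C'⊆C y (subst (y ∈_) (sym e') (∈-++⁺ʳ pre (there (here refl))))))
    ... | there q   = q
    ... | here refl = case trans (sym (loopless D l)) l→y of λ ()
  ... | rest , eq with ∷-injectiveˡ eq
  ... | refl = cong (x ∷_) (agree-after cC cC' noShort C'⊆C R R' (pre ++ [ l ]) x
                 (trans e (sym (++-assoc pre [ l ] (x ∷ R)))) (trans e' (sym (++-assoc pre [ l ] (x ∷ R'))))
                 (suc-injective le))

  -- In a digraph without shorter cycles, a cycle of length G is determined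
  -- by its vertex set and its starting vertex; so the canonical
  -- representative (starting at the least vertex) is unique.
  canonical-unique : ∀ C C' → Cycle C → Cycle C' → startsAtMin C ≡ true → startsAtMin C' ≡ true →
    length C' ≡ length C → (∀ y → y ∈ C' → y ∈ C) → NoCycleBelow (length C) → C' ≡ C
  canonical-unique [] C' cC cC' s s' lenEq C'⊆C noShort with long cC
  ... | ()
  canonical-unique (c0 ∷ cs) [] cC cC' s s' lenEq C'⊆C noShort with long cC'
  ... | ()
  canonical-unique (c0 ∷ cs) (d0 ∷ ds) cC cC' s s' lenEq C'⊆C noShort
    with Finₚ.toℕ-injective (≤-antisym (starts-at-min s' c0∈C') (starts-at-min s (C'⊆C d0 (here refl))))
    where
    c0∈C' : c0 ∈ d0 ∷ ds
    c0∈C' = same-length-⊆ (d0 ∷ ds) (c0 ∷ cs) (simple cC') (simple cC) lenEq C'⊆C c0 (here refl)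
  ... | refl = cong (d0 ∷_) (sym (agree-after cC cC' noShort C'⊆C cs ds [] d0 refl refl (suc-injective (sym lenEq))))

_⊕_ : List ℤ → List ℤ → List ℤ
[]      ⊕ q       = q
(a ∷ p) ⊕ []      = a ∷ p
(a ∷ p) ⊕ (b ∷ q) = (a ℤ.+ b) ∷ (p ⊕ q)

⊖_ : List ℤ → List ℤ
⊖ p = map -_ p

monomial : ℕ → ℤ → List ℤ
monomial zero    a = a ∷ []
monomial (suc j) a = + 0 ∷ monomial j a

eval-⊕ : ∀ p q x → eval (p ⊕ q) x ≡ eval p x ℤ.+ eval q x
eval-⊕ []      q       x = sym (ℤₚ.+-identityˡ (eval q x))
eval-⊕ (a ∷ p) []      x = sym (ℤₚ.+-identityʳ _)
eval-⊕ (a ∷ p) (b ∷ q) x = trans (cong (λ w → (a ℤ.+ b) ℤ.+ x ℤ.* w) (eval-⊕ p q x)) (regroup a b x (eval p x) (eval q x))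
  where
  regroup : ∀ a b x u v → (a ℤ.+ b) ℤ.+ x ℤ.* (u ℤ.+ v) ≡ (a ℤ.+ x ℤ.* u) ℤ.+ (b ℤ.+ x ℤ.* v)
  regroup = solve-∀

coeff-⊕ : ∀ p q j → coeff (p ⊕ q) j ≡ coeff p j ℤ.+ coeff q j
coeff-⊕ []      q       j       = sym (ℤₚ.+-identityˡ _)
coeff-⊕ (a ∷ p) []      zero    = sym (ℤₚ.+-identityʳ _)
coeff-⊕ (a ∷ p) []      (suc j) = sym (ℤₚ.+-identityʳ _)
coeff-⊕ (a ∷ p) (b ∷ q) zero    = refl
coeff-⊕ (a ∷ p) (b ∷ q) (suc j) = coeff-⊕ p q j

eval-⊖ : ∀ p x → eval (⊖ p) x ≡ - eval p x
eval-⊖ []      x = refl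
eval-⊖ (a ∷ p) x = trans (cong (λ w → - a ℤ.+ x ℤ.* w) (eval-⊖ p x)) (negate a x (eval p x))
  where
  negate : ∀ a x u → - a ℤ.+ x ℤ.* (- u) ≡ - (a ℤ.+ x ℤ.* u)
  negate = solve-∀

coeff-⊖ : ∀ p j → coeff (⊖ p) j ≡ - coeff p j
coeff-⊖ []      j       = refl
coeff-⊖ (a ∷ p) zero    = refl
coeff-⊖ (a ∷ p) (suc j) = coeff-⊖ p j

eval-monomial : ∀ j a k → eval (monomial j a) (+ k) ≡ a ℤ.* + (k ^ j)
eval-monomial zero a k =
  trans (cong (λ w → a ℤ.+ w) (ℤₚ.*-zeroʳ (+ k))) (trans (ℤₚ.+-identityʳ a) (sym (ℤₚ.*-identityʳ a)))
eval-monomial (suc j) a k =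
  trans (cong (λ w → + 0 ℤ.+ + k ℤ.* w) (eval-monomial j a k))
        (trans (shift a (+ k) (+ (k ^ j))) (cong (a ℤ.*_) (sym (ℤₚ.pos-* k (k ^ j)))))
  where
  shift : ∀ a x y → + 0 ℤ.+ x ℤ.* (a ℤ.* y) ≡ a ℤ.* (x ℤ.* y)
  shift = solve-∀

coeff-monomial : ∀ j a → coeff (monomial j a) j ≡ a
coeff-monomial zero    a = refl
coeff-monomial (suc j) a = coeff-monomial j a

coeff-monomial-other : ∀ j a i → ¬ (i ≡ j) → coeff (monomial j a) i ≡ + 0
coeff-monomial-other zero    a zero    i≢j = ⊥-elim (i≢j refl)
coeff-monomial-other zero    a (suc i) i≢j = refl
coeff-monomial-other (suc j) a zero    i≢j = refl
coeff-monomial-other (suc j) a (suc i) i≢j = coeff-monomial-other j a i (i≢j ∘′ cong suc)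

horner-bound : ∀ a r k → k * ∣ eval r (+ k) ∣ ≤ ∣ eval (a ∷ r) (+ k) ∣ + ∣ a ∣
horner-bound a r k =
  subst (_≤ ∣ a ℤ.+ + k ℤ.* eval r (+ k) ∣ + ∣ a ∣) (ℤₚ.abs-* (+ k) (eval r (+ k)))
        (subst (λ z → ∣ z ∣ ≤ ∣ a ℤ.+ x ∣ + ∣ a ∣) (cancel a x) (ℤₚ.∣i-j∣≤∣i∣+∣j∣ (a ℤ.+ x) a))
  where
  x = + k ℤ.* eval r (+ k)
  cancel : ∀ a x → (a ℤ.+ x) ℤ.- a ≡ x
  cancel = solve-∀

small-multiple : ∀ k e B → B < k → k * e ≤ B → e ≡ 0
small-multiple k zero    B B<k ke≤B = refl
small-multiple k (suc e) B B<k ke≤B = ⊥-elim (<⇒≱ B<k (≤-trans (m≤m*n k (suc e)) ke≤B))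

eventually-zero : ∀ (r : List ℤ) K → 1 ≤ K → (∀ k → K ≤ k → eval r (+ k) ≡ + 0) → ∀ j → coeff r j ≡ + 0
eventually-zero []      K K≥1 h j = refl
eventually-zero (a ∷ r) K K≥1 h j = coefficient j
  where
  -- k·|r(k)| ≤ |a| for k ≥ K, so r(k) = 0 once k > |a|
  k0 = K + ∣ a ∣
  r-k0 : eval r (+ k0) ≡ + 0
  r-k0 = ℤₚ.∣i∣≡0⇒i≡0 (small-multiple k0 _ ∣ a ∣ (m<n+m ∣ a ∣ K≥1)
           (subst (λ z → k0 * ∣ eval r (+ k0) ∣ ≤ ∣ z ∣ + ∣ a ∣) (h k0 (m≤m+n K ∣ a ∣)) (horner-bound a r k0)))
  a≡0 : a ≡ + 0
  a≡0 = trans (sym (trans (cong (λ w → a ℤ.+ + k0 ℤ.* w) r-k0)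
                          (trans (cong (λ w → a ℤ.+ w) (ℤₚ.*-zeroʳ (+ k0))) (ℤₚ.+-identityʳ a))))
              (h k0 (m≤m+n K ∣ a ∣))
  r-zero : ∀ k → K ≤ k → eval r (+ k) ≡ + 0
  r-zero (suc k′) K≤k = ℤₚ.∣i∣≡0⇒i≡0 (n≤0⇒n≡0 (≤-trans (m≤m+n _ (k′ * _)) k·r≤0))
    where
    k·r≤0 : suc k′ * ∣ eval r (+ suc k′) ∣ ≤ ∣ + 0 ∣ + ∣ + 0 ∣
    k·r≤0 = subst₂ (λ y z → suc k′ * ∣ eval r (+ suc k′) ∣ ≤ ∣ y ∣ + ∣ z ∣) (h (suc k′) K≤k) a≡0
                   (horner-bound a r (suc k′))
  r-zero zero K≤0 = case ≤-trans K≥1 K≤0 of λ ()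
  coefficient : ∀ j → coeff (a ∷ r) j ≡ + 0
  coefficient zero    = a≡0
  coefficient (suc j) = eventually-zero r K K≥1 r-zero j

bounded-degree : ∀ m (r : List ℤ) K C → 1 ≤ K → (∀ k → K ≤ k → ∣ eval r (+ k) ∣ ≤ C * k ^ m) →
  ∀ j → m < j → coeff r j ≡ + 0
bounded-degree m       []      K C K≥1 bound j       m<j       = refl
bounded-degree zero    (a ∷ r) K C K≥1 bound (suc j) _         = eventually-zero r K′ (s≤s z≤n) r-zero j
  where
  -- k·|r(k)| ≤ C + |a|, so r(k) = 0 once k > C + |a|
  B  = C * 1 + ∣ a ∣
  K′ = suc (K + B)
  r-zero : ∀ k → K′ ≤ k → eval r (+ k) ≡ + 0
  r-zero k K′≤k = ℤₚ.∣i∣≡0⇒i≡0 (small-multiple k _ B (≤-trans (s≤s (m≤n+m B K)) K′≤k)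
    (≤-trans (horner-bound a r k) (+-monoˡ-≤ ∣ a ∣ (bound k (≤-trans (≤-trans (m≤m+n K B) (n≤1+n _)) K′≤k)))))
bounded-degree (suc m) (a ∷ r) K C K≥1 bound (suc j) (s≤s m<j) =
  bounded-degree m r K (C + ∣ a ∣) K≥1 r-bound j m<j
  where
  r-bound : ∀ k → K ≤ k → ∣ eval r (+ k) ∣ ≤ (C + ∣ a ∣) * k ^ m
  r-bound zero    K≤0 = case ≤-trans K≥1 K≤0 of λ ()
  r-bound (suc k′) K≤k = *-cancelˡ-≤ k (begin
    k * ∣ eval r (+ k) ∣           ≤⟨ horner-bound a r k ⟩
    ∣ eval (a ∷ r) (+ k) ∣ + ∣ a ∣  ≤⟨ +-monoˡ-≤ ∣ a ∣ (bound k K≤k) ⟩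
    C * k ^ suc m + ∣ a ∣          ≤⟨ +-monoʳ-≤ (C * k ^ suc m) (m≤m*n ∣ a ∣ (k ^ suc m) {{m^n≢0 k (suc m)}}) ⟩
    C * k ^ suc m + ∣ a ∣ * k ^ suc m ≡⟨ sym (*-distribʳ-+ (k ^ suc m) C ∣ a ∣) ⟩
    (C + ∣ a ∣) * (k * k ^ m)      ≡⟨ x*[k*y]≡k*[x*y] (C + ∣ a ∣) k (k ^ m) ⟩
    k * ((C + ∣ a ∣) * k ^ m)      ∎)
    where
    open ≤-Reasoning
    k = suc k′
    x*[k*y]≡k*[x*y] : ∀ x k y → x * (k * y) ≡ k * (x * y)
    x*[k*y]≡k*[x*y] x k y = trans (sym (*-assoc x k y)) (trans (cong (_* y) (*-comm x k)) (*-assoc k x y))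

coeff-agree-above : ∀ m (p q : List ℤ) C → (∀ k → 1 ≤ k → ∣ eval p (+ k) ℤ.- eval q (+ k) ∣ ≤ C * k ^ m) →
  ∀ j → m < j → coeff p j ≡ coeff q j
coeff-agree-above m p q C close j m<j = ℤₚ.i-j≡0⇒i≡j _ _ (begin
  coeff p j ℤ.- coeff q j          ≡⟨ sym (trans (coeff-⊕ p (⊖ q) j) (cong (λ w → coeff p j ℤ.+ w) (coeff-⊖ q j))) ⟩
  coeff (p ⊕ (⊖ q)) j              ≡⟨ bounded-degree m (p ⊕ (⊖ q)) 1 C ≤-refl difference-bound j m<j ⟩
  + 0                              ∎)
  where
  open ≡-Reasoning
  difference-bound : ∀ k → 1 ≤ k → ∣ eval (p ⊕ (⊖ q)) (+ k) ∣ ≤ C * k ^ m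
  difference-bound k k≥1 = subst (λ z → ∣ z ∣ ≤ C * k ^ m)
    (sym (trans (eval-⊕ p (⊖ q) (+ k)) (cong (λ w → eval p (+ k) ℤ.+ w) (eval-⊖ q (+ k))))) (close k k≥1)

∣-∣-bound : ∀ a b X Y → b ≤ a + X → a ≤ b + Y → ∣ + a ℤ.- + b ∣ ≤ X + Y
∣-∣-bound a b X Y b≤a+X a≤b+Y with ≤-total a b
... | inj₁ a≤b = subst (_≤ X + Y) (sym (trans (cong ∣_∣ (ℤₚ.[+m]-[+n]≡m⊖n a b)) (ℤₚ.∣⊖∣-≤ a≤b)))
                       (≤-trans (m≤n+o⇒m∸n≤o b a b≤a+X) (m≤m+n X Y))
... | inj₂ b≤a = subst (_≤ X + Y) (sym (trans (cong ∣_∣ (ℤₚ.[+m]-[+n]≡m⊖n a b)) (trans (ℤₚ.∣m⊖n∣≡∣n⊖m∣ a b) (ℤₚ.∣⊖∣-≤ b≤a))))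
                       (≤-trans (m≤n+o⇒m∸n≤o a b a≤b+Y) (m≤n+m Y X))

module GirthCounting {n} (D : Digraph n) (g : ℕ) (has-g : hasCycleOfLength D g ≡ true)
                     (girth : Cycles.NoCycleBelow D g) where
  open Cycles D

  S : List (List (Fin n))
  S = seqs n g

  canonical : List (Fin n) → Bool
  canonical C = isCycle D C ∧ startsAtMin C

  N : ℕ
  N = count canonical S

  canonical→Cycle : ∀ {C} → canonical C ≡ true → Cycle C
  canonical→Cycle {C} e = isCycle→Cycle C (proj₁ (∧-elim {isCycle D C} e))

  some-g-cycle : Σ (List (Fin n)) λ C → C ∈ S × Cycle C
  some-g-cycle = let (C , C∈ , e) = any-true⁻ (isCycle D) S has-g in C , C∈ , isCycle→Cycle C e

  g≤n : g ≤ n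
  g≤n = let (C , C∈ , c) = some-g-cycle in subst (_≤ n) (seqs-length g C∈) (distinct-length C (simple c))

  2≤g : 2 ≤ g
  2≤g = let (C , C∈ , c) = some-g-cycle in subst (2 ≤_) (seqs-length g C∈) (long c)

  m : ℕ
  m = n ∸ g

  m+g≡n : m + g ≡ n
  m+g≡n = m∸n+n≡m g≤n

  m+2≤n : m + 2 ≤ n
  m+2≤n = subst (m + 2 ≤_) m+g≡n (+-monoʳ-≤ m 2≤g)

  free-exponent : ∀ L a → distinct L ≡ true → length L ≡ a + g → a + free L ≡ m
  free-exponent L a d len = +-cancelʳ-≡ g (a + free L) m (begin
    a + free L + g     ≡⟨ reorder a (free L) g ⟩
    free L + (a + g)   ≡⟨ cong (λ w → free L + w) (sym len) ⟩
    free L + length L  ≡⟨ free-+-length L d ⟩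
    n                  ≡⟨ sym m+g≡n ⟩
    m + g              ∎)
    where
    open ≡-Reasoning
    reorder : ∀ a f g → a + f + g ≡ f + (a + g)
    reorder = solve-ℕ

  M : ℕ
  M = sumL (λ l → length (seqs n l)) (upTo (suc n))

  module WithColours (k′ : ℕ) where

    k : ℕ
    k = suc k′

    V : List (Colouring n k)
    V = vecs k n

    monoShort : Colouring n k → List (Fin n) → Bool
    monoShort c C = canonical C ∧ mono C c

    t : Colouring n k → ℕ
    t c = count (monoShort c) S

    monoLong : ℕ → Colouring n k → List (Fin n) → Bool
    monoLong l c vs = (g <ᵇ l) ∧ (isCycle D vs ∧ mono vs c)

    u : Colouring n k → ℕ
    u c = sumL (λ l → count (monoLong l c) (seqs n l)) (upTo (suc n))

    monoPair : List (Fin n) → List (Fin n) → Colouring n k → Bool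
    monoPair C C' c = monoShort c C ∧ (monoShort c C' ∧ not (eqL C' C))

    pairs : Colouring n k → ℕ
    pairs c = sumL (λ C → count (λ C' → monoPair C C' c) S) S

    improper : Colouring n k → Bool
    improper c = not (isProper D (lookup c))

    I : ℕ
    I = count improper V

    -- an improper colouring has a monochromatic cycle, of length ≥ g by the
    -- girth assumption; rotating a g-cycle makes it canonical
    improper≤t+u : ∀ c → ind (improper c) ≤ t c + u c
    improper≤t+u c with isProper D (lookup c) in e
    ... | true = z≤n
    ... | false with all-false⁻ _ (upTo (suc n)) e
    ... | l , l∈ , e₂ with all-false⁻ _ (seqs n l) e₂
    ... | vs , vs∈ , e₃ with ∧-elim {isCycle D vs} (not-false e₃)
    ... | cyc , monoVs with <-cmp l g
    ...   | tri< l<g _ _ = ⊥-elim (case trans (sym (any-false (isCycle D) (girth l l<g) vs∈)) cyc of λ ())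
    ...   | tri> _ _ g<l = ≤-trans (≤-trans long-counted (sumL-≥ (λ l → count (monoLong l c) (seqs n l)) l∈)) (m≤n+m (u c) (t c))
      where
      long-counted : 1 ≤ count (monoLong l c) (seqs n l)
      long-counted = count-≥1 (monoLong l c) vs∈ (∧-intro (T⇒≡true (<⇒<ᵇ g<l)) (∧-intro cyc monoVs))
    ...   | tri≈ _ refl _ with canonical-rotation vs (isCycle→Cycle vs cyc)
    ...     | R , cR , sR , lenR , R⊆vs = ≤-trans (count-≥1 (monoShort c) R∈S (∧-intro (∧-intro (Cycle→isCycle R cR) sR) monoR)) (m≤m+n (t c) (u c))
      where
      R∈S : R ∈ S
      R∈S = subst (λ z → R ∈ seqs n z) (trans lenR (seqs-length l vs∈)) (seqs-∈ R)
      monoR : mono R c ≡ true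
      monoR = mono-complete R c (λ p q → mono-sound vs c monoVs (R⊆vs _ p) (R⊆vs _ q))

    -- a monochromatic canonical g-cycle makes c improper, and all but one of
    -- them are counted in the pairs
    t≤improper+pairs : ∀ c → t c ≤ ind (improper c) + pairs c
    t≤improper+pairs c with t c in et
    ... | zero   = z≤n
    ... | suc t′ with count-witness (monoShort c) S (subst (1 ≤_) (sym et) (s≤s z≤n))
    ... | C₀ , C₀∈ , short₀ with ∧-elim {canonical C₀} short₀
    ... | can₀ , mono₀ = subst (λ z → suc t′ ≤ ind (not z) + pairs c) (sym not-proper) (s≤s t′≤pairs)
      where
      not-proper : isProper D (lookup c) ≡ false
      not-proper = all-false (λ l → all (λ vs → not (isCycle D vs ∧ monochromatic (lookup c) vs)) (seqs n l))
                     (∈-upTo⁺ (s≤s g≤n))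
                     (all-false (λ vs → not (isCycle D vs ∧ monochromatic (lookup c) vs)) C₀∈
                       (cong not (∧-intro (proj₁ (∧-elim {isCycle D C₀} can₀)) mono₀)))
      others = count (λ C′ → monoShort c C′ ∧ not (eqL C′ C₀)) S
      others≤pairs : others ≤ pairs c
      others≤pairs = subst (_≤ pairs c) (count-ext (λ C′ → cong (_∧ (monoShort c C′ ∧ not (eqL C′ C₀))) short₀) S)
                           (sumL-≥ (λ C → count (λ C′ → monoPair C C′ c) S) C₀∈)
      t≤others+1 : suc t′ ≤ others + 1
      t≤others+1 = subst (_≤ others + 1) et
        (≤-trans (count-split (monoShort c) (λ C′ → eqL C′ C₀) S) (+-monoʳ-≤ others (seqs-unique g C₀)))
      t′≤pairs : t′ ≤ pairs c
      t′≤pairs = ≤-trans (≤-pred (subst (suc t′ ≤_) (+-comm others 1) t≤others+1)) others≤pairs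

    count-mono-short : ∀ C → C ∈ S → Cycle C → count (mono C) V ≡ k * k ^ m
    count-mono-short []       C∈ cC with long cC
    ... | ()
    count-mono-short (x ∷ xs) C∈ cC =
      trans (count-monochromatic x xs) (cong (λ z → k * k ^ z) (free-exponent (x ∷ xs) 0 (simple cC) (seqs-length g C∈)))

    sum-t : sumL t V ≡ N * (k * k ^ m)
    sum-t = trans (count-swap monoShort V S)
      (trans (sumL-ext∈ S (λ C C∈ → trans (count-∧ (canonical C) (mono C) V) (per-cycle C C∈)))
      (trans (sumL-*ʳ (k * k ^ m) (ind ∘ canonical) S) (cong (_* (k * k ^ m)) (sym (count-sum canonical S)))))
      where
      per-cycle : ∀ C → C ∈ S → ind (canonical C) * count (mono C) V ≡ ind (canonical C) * (k * k ^ m)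
      per-cycle C C∈ with canonical C in e
      ... | false = refl
      ... | true  = cong (1 *_) (count-mono-short C C∈ (canonical→Cycle e))

    count-mono-long : ∀ l vs → vs ∈ seqs n l → g < l → Cycle vs → count (mono vs) V ≤ k ^ m
    count-mono-long l []       vs∈ g<l cV with long cV
    ... | ()
    count-mono-long l (x ∷ xs) vs∈ g<l cV = subst (_≤ k ^ m) (sym (count-monochromatic x xs))
      (^-monoʳ-≤ k (≤-trans (+-monoˡ-≤ (free (x ∷ xs)) (m<n⇒0<n∸m g<l))
        (≤-reflexive (free-exponent (x ∷ xs) (l ∸ g) (simple cV) (trans (seqs-length l vs∈) (sym (m∸n+n≡m (<⇒≤ g<l))))))))

    count-monoLong : ∀ l vs → vs ∈ seqs n l → count (λ c → monoLong l c vs) V ≤ k ^ m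
    count-monoLong l vs vs∈ = subst (_≤ k ^ m) (sym factored) (bound (g <ᵇ l) (isCycle D vs) refl refl)
      where
      factored : count (λ c → monoLong l c vs) V ≡ ind (g <ᵇ l) * (ind (isCycle D vs) * count (mono vs) V)
      factored = trans (count-∧ (g <ᵇ l) (λ c → isCycle D vs ∧ mono vs c) V)
                       (cong (ind (g <ᵇ l) *_) (count-∧ (isCycle D vs) (mono vs) V))
      bound : ∀ b₁ b₂ → (g <ᵇ l) ≡ b₁ → isCycle D vs ≡ b₂ → ind b₁ * (ind b₂ * count (mono vs) V) ≤ k ^ m
      bound false b₂    _  _   = z≤n
      bound true  false _  _   = z≤n
      bound true  true  gl cyc = subst (_≤ k ^ m) (sym (trans (+-identityʳ _) (+-identityʳ _)))
        (count-mono-long l vs vs∈ (<ᵇ⇒< g l (≡true⇒T gl)) (isCycle→Cycle vs cyc))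

    sum-u : sumL u V ≤ M * k ^ m
    sum-u = begin
      sumL u V
        ≡⟨ sumL-swap (λ l c → count (monoLong l c) (seqs n l)) (upTo (suc n)) V ⟩
      sumL (λ l → sumL (λ c → count (monoLong l c) (seqs n l)) V) (upTo (suc n))
        ≤⟨ sumL-mono (λ l → ≤-trans (≤-reflexive (count-swap (λ c vs → monoLong l c vs) V (seqs n l)))
                                      (sumL-bound (k ^ m) (seqs n l) (count-monoLong l))) (upTo (suc n)) ⟩
      sumL (λ l → length (seqs n l) * k ^ m) (upTo (suc n))
        ≡⟨ sumL-*ʳ (k ^ m) (λ l → length (seqs n l)) (upTo (suc n)) ⟩
      M * k ^ m ∎
      where open ≤-Reasoning

    -- Let C, C′ be g-cycles and v a vertex of C′ outside C. The colourings
    -- making both monochromatic number at most k^m: if C′ meets C in w, such a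
    -- colouring is constant on v ∷ C (g + 1 vertices, one colour) ...
    count-mono-meeting : ∀ C C′ v w → C ∈ S → Cycle C → v ∈ C′ → memb C v ≡ false → w ∈ C → w ∈ C′ →
      count (λ c → mono C c ∧ mono C′ c) V ≤ k ^ m
    count-mono-meeting C C′ v w C∈ cC v∈C′ v∉C w∈C w∈C′ =
      ≤-trans (count-≤ {p = λ c → mono C c ∧ mono C′ c} {q = mono (v ∷ C)} (λ c both → mono-complete (v ∷ C) c (constant c both)) V)
              (≤-reflexive (trans (count-monochromatic v C)
                (cong (k ^_) (free-exponent (v ∷ C) 1 (∧-intro (cong not v∉C) (simple cC)) (cong suc (seqs-length g C∈))))))
      where
      constant : ∀ c → mono C c ∧ mono C′ c ≡ true → ∀ {y z} → y ∈ v ∷ C → z ∈ v ∷ C → lookup c y ≡ lookup c z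
      constant c both y∈ z∈ = trans (to-w y∈) (sym (to-w z∈))
        where
        to-w : ∀ {x} → x ∈ v ∷ C → lookup c x ≡ lookup c w
        to-w (here refl) = mono-sound C′ c (proj₂ (∧-elim {mono C c} both)) v∈C′ w∈C′
        to-w (there x∈C) = mono-sound C c (proj₁ (∧-elim {mono C c} both)) x∈C w∈C

    -- ... and if C′ is disjoint from C, it is constant on C and on the first
    -- two vertices of C′ (g + 2 vertices, two colours).
    count-mono-disjoint : ∀ C C′ → C ∈ S → Cycle C → Cycle C′ → (∀ {y} → y ∈ C′ → memb C y ≡ false) →
      count (λ c → mono C c ∧ mono C′ c) V ≤ k ^ m
    count-mono-disjoint [] C′ C∈ cC cC′ d∉C with long cC
    ... | ()
    count-mono-disjoint (x ∷ xs) [] C∈ cC cC′ d∉C with long cC′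
    ... | ()
    count-mono-disjoint (x ∷ xs) (d₀ ∷ []) C∈ cC cC′ d∉C with long cC′
    ... | s≤s ()
    count-mono-disjoint (x ∷ xs) (d₀ ∷ d₁ ∷ ds) C∈ cC cC′ d∉C =
      ≤-trans (count-≤ {p = λ c → mono (x ∷ xs) c ∧ mono (d₀ ∷ d₁ ∷ ds) c} {q = λ c → mono (x ∷ xs) c ∧ mono (d₀ ∷ d₁ ∷ []) c} (λ c both → ∧-intro (proj₁ (∧-elim {mono (x ∷ xs) c} both))
                                   (mono-complete (d₀ ∷ d₁ ∷ []) c (λ p q → mono-sound (d₀ ∷ d₁ ∷ ds) c
                                      (proj₂ (∧-elim {mono (x ∷ xs) c} both)) (first-two p) (first-two q)))) V)
      (≤-trans (count-mono-two (x ∷ xs) (d₀ ∷ d₁ ∷ []) x d₀ (here refl) (here refl) (λ y y∈ → d∉C (first-two y∈)))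
               (≤-reflexive (cong (k ^_) (free-exponent L 2 distinct-L (cong (λ w → 2 + w) (seqs-length g C∈))))))
      where
      L = (d₀ ∷ d₁ ∷ []) ++ x ∷ xs
      first-two : ∀ {y} → y ∈ d₀ ∷ d₁ ∷ [] → y ∈ d₀ ∷ d₁ ∷ ds
      first-two (here refl)         = here refl
      first-two (there (here refl)) = there (here refl)
      d₀≢d₁ : eqᵇ d₀ d₁ ≡ false
      d₀≢d₁ with eqᵇ d₀ d₁ in e
      ... | false = refl
      ... | true  = case trans (sym (distinct-head d₀ (d₁ ∷ ds) (simple cC′)))
                               (∈→memb {L = d₁ ∷ ds} (here (eqᵇ-true e))) of λ ()
      distinct-L : distinct L ≡ true
      distinct-L = ∧-intro (cong not (trans (cong (eqᵇ d₀ d₁ ∨_) (d∉C (here refl))) (cong (_∨ false) d₀≢d₁)))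
                           (∧-intro (cong not (d∉C (there (here refl)))) (simple cC))

    -- different canonical g-cycles C′ ≠ C are both monochromatic under at most
    -- k^m colourings: by uniqueness of canonical representatives, C′ has a
    -- vertex outside C
    count-different-cycles : ∀ C C′ → C ∈ S → C′ ∈ S → canonical C ≡ true → canonical C′ ≡ true →
      eqL C′ C ≡ false → count (λ c → mono C c ∧ mono C′ c) V ≤ k ^ m
    count-different-cycles C C′ C∈ C′∈ can can′ C′≢C with all (memb C) C′ in inside
    ... | true  = case trans (sym C′≢C) (subst (λ z → eqL z C ≡ true) (sym C′≡C) (eqL-refl C)) of λ ()
      where
      C′≡C : C′ ≡ C
      C′≡C = canonical-unique C C′ (canonical→Cycle can) (canonical→Cycle can′)
               (proj₂ (∧-elim {isCycle D C} can)) (proj₂ (∧-elim {isCycle D C′} can′))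
               (trans (seqs-length g C′∈) (sym (seqs-length g C∈)))
               (λ y y∈ → memb→∈ {L = C} (all-true (memb C) inside y∈))
               (subst NoCycleBelow (sym (seqs-length g C∈)) girth)
    ... | false with all-false⁻ (memb C) C′ inside | any (memb C) C′ in meets
    ...   | v , v∈C′ , v∉C | true  = let (w , w∈C′ , w∈C) = any-true⁻ (memb C) C′ meets in
      count-mono-meeting C C′ v w C∈ (canonical→Cycle can) v∈C′ v∉C (memb→∈ {L = C} w∈C) w∈C′
    ...   | _              | false =
      count-mono-disjoint C C′ C∈ (canonical→Cycle can) (canonical→Cycle can′) (any-false (memb C) meets)

    pairCondition : List (Fin n) → List (Fin n) → Bool
    pairCondition C C′ = canonical C ∧ (canonical C′ ∧ not (eqL C′ C))

    monoPair-elim : ∀ {C C′ c} → monoPair C C′ c ≡ true → pairCondition C C′ ≡ true × (mono C c ∧ mono C′ c) ≡ true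
    monoPair-elim {C} {C′} {c} e with ∧-elim {monoShort c C} e
    ... | short , rest with ∧-elim {monoShort c C′} rest | ∧-elim {canonical C} short
    ... | short′ , different | can , monoC with ∧-elim {canonical C′} short′
    ... | can′ , monoC′ = ∧-intro can (∧-intro can′ different) , ∧-intro monoC monoC′

    count-monoPair : ∀ C C′ → C ∈ S → C′ ∈ S → count (monoPair C C′) V ≤ k ^ m
    count-monoPair C C′ C∈ C′∈ with pairCondition C C′ in cond
    ... | false = subst (_≤ k ^ m) (sym (count-false never V)) z≤n
      where
      never : ∀ c → monoPair C C′ c ≡ false
      never c with monoPair C C′ c in e
      ... | false = refl
      ... | true  = case trans (sym cond) (proj₁ (monoPair-elim {C} {C′} {c} e)) of λ ()
    ... | true with ∧-elim {canonical C} cond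
    ... | can , rest with ∧-elim {canonical C′} rest
    ... | can′ , different =
      ≤-trans (count-≤ (λ c e → proj₂ (monoPair-elim {C} {C′} {c} e)) V)
              (count-different-cycles C C′ C∈ C′∈ can can′ (not-true different))

    sum-pairs : sumL pairs V ≤ length S * length S * k ^ m
    sum-pairs = begin
      sumL pairs V
        ≡⟨ sumL-swap (λ C c → count (λ C′ → monoPair C C′ c) S) S V ⟩
      sumL (λ C → sumL (λ c → count (λ C′ → monoPair C C′ c) S) V) S
        ≤⟨ sumL-bound (length S * k ^ m) S (λ C C∈ → ≤-trans (≤-reflexive (count-swap (λ c C′ → monoPair C C′ c) V S))
                                                             (sumL-bound (k ^ m) S (λ C′ C′∈ → count-monoPair C C′ C∈ C′∈))) ⟩
      length S * (length S * k ^ m)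
        ≡⟨ sym (*-assoc (length S) (length S) (k ^ m)) ⟩
      length S * length S * k ^ m ∎
      where open ≤-Reasoning

    improper-upper : I ≤ N * (k * k ^ m) + M * k ^ m
    improper-upper = begin
      I                           ≡⟨ count-sum improper V ⟩
      sumL (ind ∘ improper) V     ≤⟨ sumL-mono improper≤t+u V ⟩
      sumL (λ c → t c + u c) V    ≡⟨ sumL-+ t u V ⟩
      sumL t V + sumL u V         ≤⟨ +-mono-≤ (≤-reflexive sum-t) sum-u ⟩
      N * (k * k ^ m) + M * k ^ m ∎
      where open ≤-Reasoning

    improper-lower : N * (k * k ^ m) ≤ I + length S * length S * k ^ m
    improper-lower = begin
      N * (k * k ^ m)                           ≡⟨ sym sum-t ⟩
      sumL t V                                  ≤⟨ sumL-mono t≤improper+pairs V ⟩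
      sumL (λ c → ind (improper c) + pairs c) V ≡⟨ sumL-+ (ind ∘ improper) pairs V ⟩
      sumL (ind ∘ improper) V + sumL pairs V    ≤⟨ +-mono-≤ (≤-reflexive (sym (count-sum improper V))) sum-pairs ⟩
      I + length S * length S * k ^ m           ∎
      where open ≤-Reasoning

    proper+improper : numColourings D k + I ≡ k ^ n
    proper+improper = trans (count-compl (λ c → isProper D (lookup c)) V) (count-all-colourings k n)

  leading : List ℤ
  leading = monomial n (+ 1) ⊕ monomial (suc m) (- (+ N))

  -- P(k) = k^n − N·k^(m+1) + O(k^m): the improper colourings number
  -- N·k^(m+1) up to (M + |S|²)·k^m
  chromatic-estimate : ∀ p → IsChromaticPolynomial D p → ∀ k → 1 ≤ k →
    ∣ eval p (+ k) ℤ.- eval leading (+ k) ∣ ≤ (M + length S * length S) * k ^ m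
  chromatic-estimate p isP (suc k′) _ =
    subst₂ (λ z b → ∣ z ∣ ≤ b) (sym difference) (sym (*-distribʳ-+ (k ^ m) M (length S * length S)))
      (∣-∣-bound (N * (k * k ^ m)) I (M * k ^ m) (length S * length S * k ^ m) improper-upper improper-lower)
    where
    open WithColours k′
    open ≡-Reasoning
    P = numColourings D k
    rearrange : ∀ x i a → x ℤ.- (+ 1 ℤ.* (x ℤ.+ i) ℤ.+ (- a)) ≡ a ℤ.- i
    rearrange = solve-∀
    difference : eval p (+ k) ℤ.- eval leading (+ k) ≡ + (N * (k * k ^ m)) ℤ.- + I
    difference = begin
      eval p (+ k) ℤ.- eval leading (+ k)
        ≡⟨ cong₂ ℤ._-_ (isP k (s≤s z≤n)) (eval-⊕ (monomial n (+ 1)) (monomial (suc m) (- (+ N))) (+ k)) ⟩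
      + P ℤ.- (eval (monomial n (+ 1)) (+ k) ℤ.+ eval (monomial (suc m) (- (+ N))) (+ k))
        ≡⟨ cong₂ (λ a b → + P ℤ.- (a ℤ.+ b)) (eval-monomial n (+ 1) k) (eval-monomial (suc m) (- (+ N)) k) ⟩
      + P ℤ.- (+ 1 ℤ.* + (k ^ n) ℤ.+ (- (+ N)) ℤ.* + (k ^ suc m))
        ≡⟨ cong₂ (λ a b → + P ℤ.- (+ 1 ℤ.* a ℤ.+ b)) (trans (cong +_ (sym proper+improper)) (ℤₚ.pos-+ P I))
                 (trans (sym (ℤₚ.neg-distribˡ-* (+ N) (+ (k ^ suc m)))) (cong -_ (sym (ℤₚ.pos-* N (k ^ suc m))))) ⟩
      + P ℤ.- (+ 1 ℤ.* (+ P ℤ.+ + I) ℤ.+ (- (+ (N * k ^ suc m))))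
        ≡⟨ rearrange (+ P) (+ I) (+ (N * k ^ suc m)) ⟩
      + (N * (k * k ^ m)) ℤ.- + I ∎

  top-coefficients : ∀ p → IsChromaticPolynomial D p → ∀ j → m < j →
    coeff p j ≡ coeff (monomial n (+ 1)) j ℤ.+ coeff (monomial (suc m) (- (+ N))) j
  top-coefficients p isP j m<j =
    trans (coeff-agree-above m p leading (M + length S * length S) (chromatic-estimate p isP) j m<j)
          (coeff-⊕ (monomial n (+ 1)) (monomial (suc m) (- (+ N))) j)

mainTheorem8 : ∀ (n : ℕ) (D : Digraph n) (g : ℕ)
    → hasCycleOfLength D g ≡ true
    → (∀ l → l < g → hasCycleOfLength D l ≡ false)
    → (p : List ℤ) → IsChromaticPolynomial D p
    → (∀ j → n ∸ g + 2 ≤ j → j < n → coeff p j ≡ + 0)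
      × (coeff p (n ∸ g + 1) ≡ - (+ numCycles D g))
mainTheorem8 n D g has-g girth p isP = vanishing , subleading
  where
  open GirthCounting D g has-g girth using (m; N; m+2≤n; top-coefficients)
  vanishing : ∀ j → m + 2 ≤ j → j < n → coeff p j ≡ + 0
  vanishing j m+2≤j j<n =
    trans (top-coefficients p isP j (<-trans (n<1+n m) m+1<j))
          (cong₂ ℤ._+_ (coeff-monomial-other n (+ 1) j (<⇒≢ j<n)) (coeff-monomial-other (suc m) _ j (≢-sym (<⇒≢ m+1<j))))
    where
    m+1<j : suc m < j
    m+1<j = subst (_≤ j) (+-comm m 2) m+2≤j
  subleading : coeff p (m + 1) ≡ - (+ N)
  subleading = begin
    coeff p (m + 1)  ≡⟨ cong (coeff p) (+-comm m 1) ⟩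
    coeff p (suc m)  ≡⟨ top-coefficients p isP (suc m) (n<1+n m) ⟩
    coeff (monomial n (+ 1)) (suc m) ℤ.+ coeff (monomial (suc m) (- (+ N))) (suc m)
                     ≡⟨ cong₂ ℤ._+_ (coeff-monomial-other n (+ 1) (suc m) (<⇒≢ (subst (_≤ n) (+-comm m 2) m+2≤n)))
                                   (coeff-monomial (suc m) (- (+ N))) ⟩
    + 0 ℤ.+ - (+ N)  ≡⟨ ℤₚ.+-identityˡ (- (+ N)) ⟩
    - (+ N)          ∎
    where open ≡-Reasoning
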